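{- The set $\mathrm{Sort}(\mathfrak{s}_{\underline{32}1})=\bigcup_{n\ge1}\mathrm{Sort}_n(\mathfrak{s}_{\underline{32}1})$ is not a permutation class: $2314\in\mathrm{Sort}(\mathfrak{s}_{\underline{32}1})$ contains $123$, but $123\notin\mathrm{Sort}(\mathfrak{s}_{\underline{32}1})$.
   Context: A permutation class is a set of permutations closed under (classical) pattern containment. A pattern is a permutation $\sigma$ in which some blocks of consecutive entries may be underlined; a sequence contains it if it has a subsequence order-isomorphic to $\sigma$ whose entries corresponding to a common underlined block are adjacent in the sequence. Pattern-avoiding stack map $\mathfrak{s}_\sigma$: process input $\tau_1,\dots,\tau_n$ in order; when $\tau_i$ is next, while the stack is nonempty and the sequence formed by placing $\tau_i$ on top of the stack, read top to bottom, contains $\sigma$ (underlined entries adjacent in the stack), pop the top entry to the output; then push $\tau_i$; at the end pop all remaining entries top to bottom to the output. $\mathrm{Sort}_n(\mathfrak{s}_\sigma)$ is the set of $\tau\in\mathfrak S_n$ such that $\mathfrak{s}_\sigma(\tau)$ avoids $231$ (equivalently, is sorted to the identity by West's stack-sorting map). -}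

module Defs where

open import Data.Nat using (ℕ; zero; suc; _<_; _≤_; _<ᵇ_)
open import Data.Bool using (Bool; true; false; if_then_else_; _∧_; _∨_)
open import Data.List using (List; []; _∷_; _++_; length; map; upTo)
open import Data.Bool.ListAction using (any)
open import Data.List.Relation.Binary.Sublist.Propositional using (_⊆_)
open import Data.List.Relation.Binary.Permutation.Propositional using (_↭_)
open import Data.Product using (_×_; _,_; ∃-syntax)
open import Function.Bundles using (_⇔_)
open import Relation.Nullary using (¬_)

-- Permutations are words over ℕ; a permutation of length n is a rearrangement of 1,…,n.

-- safe indexing (default 0, only used below the length)
at : List ℕ → ℕ → ℕ
at []       _       = 0
at (x ∷ xs) zero    = x
at (x ∷ xs) (suc i) = at xs i

OrderIso : List ℕ → List ℕ → Set
OrderIso a b = length a ≡ℕ length b × (∀ i j → i < length a → j < length a → (at a i < at a j ⇔ at b i < at b j))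
  where
  open import Relation.Binary.PropositionalEquality using () renaming (_≡_ to _≡ℕ_)

Contains : List ℕ → List ℕ → Set
Contains w p = ∃[ s ] (s ⊆ w × OrderIso s p)

Avoids : List ℕ → List ℕ → Set
Avoids w p = ¬ Contains w p

IsPerm : List ℕ → Set
IsPerm w = 1 ≤ length w × (w ↭ map suc (upTo (length w)))

-- containment of the pattern 3̲2̲1 (entries playing 3 and 2 adjacent):
-- positions i, i+1, k > i+1 with w_i > w_{i+1} > w_k
contains32u1 : List ℕ → Bool
contains32u1 []                = false
contains32u1 (a ∷ [])          = false
contains32u1 (a ∷ bs@(b ∷ rest)) = ((b <ᵇ a) ∧ any (λ c → c <ᵇ b) rest) ∨ contains32u1 bs

-- Stacks are lists with the head being the top.
-- Returns (new stack, popped entries in output order).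
pushStep : ℕ → List ℕ → List ℕ × List ℕ
pushStep x []       = (x ∷ [] , [])
pushStep x (y ∷ st) with contains32u1 (x ∷ y ∷ st)
... | true  with pushStep x st
...   | (s' , o) = (s' , y ∷ o)
pushStep x (y ∷ st) | false = (x ∷ y ∷ st , [])

runStack : List ℕ → List ℕ → List ℕ
runStack []       st = st
runStack (x ∷ xs) st with pushStep x st
... | (s' , o) = o ++ runStack xs s'

s32u1 : List ℕ → List ℕ
s32u1 τ = runStack τ []

InSort : List ℕ → Set
InSort τ = IsPerm τ × Avoids (s32u1 τ) (2 ∷ 3 ∷ 1 ∷ [])

IsPermClass : (List ℕ → Set) → Set
IsPermClass C = ∀ τ σ → IsPerm σ → C τ → Contains τ σ → C σ

{-# OPTIONS --safe #-}
module Submission where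

-- The stack map sends 2314 to 4132, which avoids 231, but sends 123 to 231
-- itself; since 123 occurs in 2314 (as 234), Sort(s_{3̲2̲1}) is not closed
-- under pattern containment.

open import Defs
open import Data.Bool using (Bool; false; T; _∧_; _∨_)
open import Data.Bool.ListAction using (any)
open import Data.Bool.Properties using (T-∧; T-∨)
open import Data.List using (List; []; _∷_; length; map)
open import Data.List.Properties using (length-map)
open import Data.List.Relation.Binary.Permutation.Propositional using (refl; prep; swap; trans)
open import Data.List.Relation.Binary.Sublist.Propositional using (_⊆_; []; _∷_; _∷ʳ_; ⊆-refl; lookup)
open import Data.List.Relation.Unary.Any using (here)
open import Data.List.Relation.Unary.Any.Properties using (any⁺)
open import Data.Nat using (ℕ; zero; suc; _<_; _<ᵇ_; s<s; s<s⁻¹; z≤n; s≤s)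
open import Data.Nat.Properties using (<⇒<ᵇ)
open import Data.Product using (_×_; _,_)
open import Data.Sum using (inj₁; inj₂)
open import Function using (id)
open import Function.Bundles using (_⇔_; mk⇔; module Equivalence)
open import Relation.Binary.PropositionalEquality using (_≡_; refl; sym; subst)
open import Relation.Nullary using (¬_)

open Equivalence using (from)

OrderIso-refl : ∀ w → OrderIso w w
OrderIso-refl w = refl , λ _ _ _ _ → mk⇔ id id

Contains-refl : ∀ w → Contains w w
Contains-refl w = w , ⊆-refl , OrderIso-refl w

at-map : ∀ (f : ℕ → ℕ) p i → i < length (map f p) → at (map f p) i ≡ f (at p i)
at-map f (x ∷ p) zero    _         = refl
at-map f (x ∷ p) (suc i) (s<s i<n) = at-map f p i i<n

map-OrderIso : ∀ (f : ℕ → ℕ) → (∀ {m n} → f m < f n ⇔ m < n) → ∀ p → OrderIso (map f p) p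
map-OrderIso f f-embedding p = length-map f p , at-<⇔
  where
  at-<⇔ : ∀ i j → i < length (map f p) → j < length (map f p) →
          at (map f p) i < at (map f p) j ⇔ at p i < at p j
  at-<⇔ i j i<n j<n rewrite at-map f p i i<n | at-map f p j j<n = f-embedding

suc-<⇔ : ∀ {m n} → suc m < suc n ⇔ m < n
suc-<⇔ = mk⇔ s<s⁻¹ s<s

starts231ᵇ : ℕ → List ℕ → Bool
starts231ᵇ a []      = false
starts231ᵇ a (b ∷ w) = ((a <ᵇ b) ∧ any (_<ᵇ a) w) ∨ starts231ᵇ a w

contains231ᵇ : List ℕ → Bool
contains231ᵇ []      = false
contains231ᵇ (a ∷ w) = starts231ᵇ a w ∨ contains231ᵇ w

starts231ᵇ-complete : ∀ {a b c w} → b ∷ c ∷ [] ⊆ w → c < a → a < b → T (starts231ᵇ a w)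
starts231ᵇ-complete (_ ∷ʳ bc⊆w)    c<a a<b = from T-∨ (inj₂ (starts231ᵇ-complete bc⊆w c<a a<b))
starts231ᵇ-complete {a} (refl ∷ c⊆w) c<a a<b =
  from T-∨ (inj₁ (from T-∧ (<⇒<ᵇ a<b , any⁺ (_<ᵇ a) (lookup c⊆w (here (<⇒<ᵇ c<a))))))

contains231ᵇ-complete : ∀ {a b c w} → a ∷ b ∷ c ∷ [] ⊆ w → c < a → a < b → T (contains231ᵇ w)
contains231ᵇ-complete (_ ∷ʳ abc⊆w)   c<a a<b = from T-∨ (inj₂ (contains231ᵇ-complete abc⊆w c<a a<b))
contains231ᵇ-complete (refl ∷ bc⊆w) c<a a<b = from T-∨ (inj₁ (starts231ᵇ-complete bc⊆w c<a a<b))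

Contains-231⇒contains231ᵇ : ∀ {w} → Contains w (2 ∷ 3 ∷ 1 ∷ []) → T (contains231ᵇ w)
Contains-231⇒contains231ᵇ (a ∷ b ∷ c ∷ [] , abc⊆w , _ , iso) =
  contains231ᵇ-complete abc⊆w
    (from (iso 2 0 (s≤s (s≤s (s≤s z≤n))) (s≤s z≤n)) (s≤s (s≤s z≤n)))
    (from (iso 0 1 (s≤s z≤n) (s≤s (s≤s z≤n))) (s≤s (s≤s (s≤s z≤n))))
Contains-231⇒contains231ᵇ ([]                    , _ , () , _)
Contains-231⇒contains231ᵇ (_ ∷ []                , _ , () , _)
Contains-231⇒contains231ᵇ (_ ∷ _ ∷ []            , _ , () , _)
Contains-231⇒contains231ᵇ (_ ∷ _ ∷ _ ∷ _ ∷ _     , _ , () , _)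

¬IsPermClass : ∀ {C τ σ} → IsPerm σ → C τ → Contains τ σ → ¬ C σ → ¬ IsPermClass C
¬IsPermClass σ-perm τ∈C τ⊇σ σ∉C isClass = σ∉C (isClass _ _ σ-perm τ∈C τ⊇σ)

s32u1-2314 : s32u1 (2 ∷ 3 ∷ 1 ∷ 4 ∷ []) ≡ 4 ∷ 1 ∷ 3 ∷ 2 ∷ []
s32u1-2314 = refl

s32u1-123 : s32u1 (1 ∷ 2 ∷ 3 ∷ []) ≡ 2 ∷ 3 ∷ 1 ∷ []
s32u1-123 = refl

2314∈Sort : InSort (2 ∷ 3 ∷ 1 ∷ 4 ∷ [])
-- Avoidance of 231 by 4132 holds because T (contains231ᵇ (4 ∷ 1 ∷ 3 ∷ 2 ∷ [])) computes to ⊥.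
2314∈Sort = (s≤s z≤n , trans (prep 2 (swap 3 1 refl)) (swap 2 1 refl)) ,
  subst (λ w → Avoids w (2 ∷ 3 ∷ 1 ∷ [])) (sym s32u1-2314) Contains-231⇒contains231ᵇ

123∉Sort : ¬ InSort (1 ∷ 2 ∷ 3 ∷ [])
123∉Sort (_ , avoids) =
  avoids (subst (λ w → Contains w (2 ∷ 3 ∷ 1 ∷ [])) (sym s32u1-123) (Contains-refl _))

2314⊇123 : Contains (2 ∷ 3 ∷ 1 ∷ 4 ∷ []) (1 ∷ 2 ∷ 3 ∷ [])
2314⊇123 = map suc (1 ∷ 2 ∷ 3 ∷ []) , refl ∷ refl ∷ 1 ∷ʳ refl ∷ [] , map-OrderIso suc suc-<⇔ (1 ∷ 2 ∷ 3 ∷ [])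

mainTheorem9 : ¬ IsPermClass InSort
    × InSort (2 ∷ 3 ∷ 1 ∷ 4 ∷ [])
    × Contains (2 ∷ 3 ∷ 1 ∷ 4 ∷ []) (1 ∷ 2 ∷ 3 ∷ [])
    × ¬ InSort (1 ∷ 2 ∷ 3 ∷ [])
mainTheorem9 = ¬IsPermClass (s≤s z≤n , refl) 2314∈Sort 2314⊇123 123∉Sort , 2314∈Sort , 2314⊇123 , 123∉Sort
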